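{- Let $W_{\Delta,n}$ be a Knödel graph with $\Delta\ge3$ and let $s=2^{\Delta-1}-1$. Let $k\ge\Delta-2$ be an integer. (i) If $(4k-2)s+4\le n\le 4ks+2$, then $\operatorname{diam}(W_{\Delta,n})=2k+1$. (ii) If $4ks+4\le n\le(4k+2)s+2$, then $\operatorname{diam}(W_{\Delta,n})=2k+2$.
   Context: Knödel graph: for an even integer $n$ and an integer $\Delta$ with $1\le\Delta\le\lfloor\log_2 n\rfloor$, $W_{\Delta,n}$ is the simple bipartite graph with vertex set $U\cup V$, $U=\{u_0,\dots,u_{n/2-1}\}$, $V=\{v_0,\dots,v_{n/2-1}\}$; indices are read modulo $n/2$. The vertices $u_i$ and $v_j$ are adjacent iff $j-i\equiv 2^k-1\pmod{n/2}$ for some $k\in\{0,\dots,\Delta-1\}$; no other edges. $\operatorname{diam}$ is the largest graph distance between two vertices. -}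

module Defs where

open import Data.Nat using (ℕ; zero; suc; _+_; _*_; _∸_; _^_; _≤_; _<_)
open import Data.Fin using (Fin; toℕ)
open import Data.Sum using (_⊎_; inj₁; inj₂)
open import Data.Product using (Σ; ∃; ∃-syntax; _×_)
open import Data.Empty using (⊥)
open import Relation.Nullary using (¬_)
open import Relation.Binary.PropositionalEquality using (_≡_)

-- Vertices of W_{Δ,n} with n = 2m:  inj₁ i = u_i ,  inj₂ j = v_j  (i, j ∈ {0,…,m-1}).
KVertex : ℕ → Set
KVertex m = Fin m ⊎ Fin m

-- j - i ≡ 2^k - 1 (mod m), written for naturals as: i + (2^k - 1) ≡ j + q·m for some q.
-- (Since i, j < m this is exactly the congruence j - i ≡ 2^k - 1 mod m.)
KEdge : (Δ m : ℕ) → Fin m → Fin m → Set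
KEdge Δ m i j = ∃[ k ] (k < Δ × ∃[ q ] (toℕ i + (2 ^ k ∸ 1) ≡ toℕ j + q * m))

KAdj : (Δ m : ℕ) → KVertex m → KVertex m → Set
KAdj Δ m (inj₁ i) (inj₂ j) = KEdge Δ m i j
KAdj Δ m (inj₂ j) (inj₁ i) = KEdge Δ m i j
KAdj Δ m (inj₁ _) (inj₁ _) = ⊥
KAdj Δ m (inj₂ _) (inj₂ _) = ⊥

data Walk {V : Set} (Adj : V → V → Set) : V → V → ℕ → Set where
  here : ∀ {x} → Walk Adj x x 0
  step : ∀ {x y z ℓ} → Adj x y → Walk Adj y z ℓ → Walk Adj x z (suc ℓ)

DistLe : {V : Set} (Adj : V → V → Set) → V → V → ℕ → Set
DistLe Adj x y D = ∃[ ℓ ] (ℓ ≤ D × Walk Adj x y ℓ)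

HasDiameter : (V : Set) (Adj : V → V → Set) → ℕ → Set
HasDiameter V Adj D =
  ((x y : V) → DistLe Adj x y D) ×
  (∃[ x ] ∃[ y ] ((ℓ : ℕ) → ℓ < D → ¬ Walk Adj x y ℓ))

module Submission where

-- Walking u → v along an edge of class a ≤ L adds 2^a - 1 to the index (mod m), walking
-- v → u subtracts it.  Hence a walk of length 2t between vertices of one side realises
-- exactly the shifts  Σ_{i<t} (2^{a_i} - 1) − Σ_{i<t} (2^{b_i} - 1)  (mod m).
--   * Counting lemma (`represent`): if t ≥ L - 1, every 0 ≤ y ≤ t·s is such a difference;
--     proved by induction on L, halving y (all classes shift by one) or filling from the top.
--   * Upper bound (`allWithin`): any two indices are ≤ t·s apart in one direction when
--     m ≤ 2ts + 1, so same-side vertices are within 2t steps; u_i and v_j are within 2t + 1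
--     steps (one extra edge of class 0 or L) when m ≤ 2ts + s + 1.
--   * Lower bound (`beyondReach`): a walk from u_0 with f forward and b backward steps ends
--     at an index ≡ F - B with F ≤ f·s, B ≤ b·s; counting parities shows v_{ks+1} (part (i))
--     resp. u_{ks+1} (part (ii)) is out of reach of shorter walks.

open import Defs
open import Data.Nat using (ℕ; zero; suc; _+_; _*_; _∸_; _^_; _≤_; _<_; z≤n; s≤s; s≤s⁻¹; _≤?_)
open import Data.Nat.Properties
open import Algebra.Properties.CommutativeSemigroup +-commutativeSemigroup using (xy∙z≈xz∙y)
open import Data.Nat.DivMod
  using (_/_; _%_; _mod_; m≡m%n+[m/n]*n; m%n<n; m<n*o⇒m/o<n; [m+kn]%n≡m%n; [m+n]%n≡m%n;
         %-distribˡ-+; m<n⇒m%n≡m; m%n%n≡m%n)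
open import Data.Nat.Logarithm using (⌊log₂_⌋)
open import Data.Nat.Tactic.RingSolver using (solve-∀)
open import Data.Fin as Fin using (Fin; toℕ; fromℕ<)
import Data.Fin.Properties as Finₚ
open import Data.List using (List; []; _∷_; length; map; replicate; _++_)
open import Data.List.Properties using (length-map; length-replicate; length-++)
open import Data.List.Relation.Unary.All as All using (All; []; _∷_)
open import Data.List.Relation.Unary.All.Properties using (++⁺; map⁺; replicate⁺)
open import Data.Product using (∃; ∃-syntax; _×_; _,_)
open import Data.Sum using (_⊎_; inj₁; inj₂)
import Data.Sum as Sum
open import Data.Empty using (⊥; ⊥-elim)
open import Level using (0ℓ)
open import Relation.Nullary using (¬_; yes; no)
open import Relation.Binary.Bundles using (Setoid)
import Relation.Binary.Reasoning.Setoid as SetoidReasoning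
open import Relation.Binary.PropositionalEquality hiding (J)

offset : ℕ → ℕ
offset a = 2 ^ a ∸ 1

2^a≡1+offset : ∀ a → 2 ^ a ≡ suc (offset a)
2^a≡1+offset zero = refl
2^a≡1+offset (suc a) rewrite 2^a≡1+offset a = refl

offset-suc : ∀ a → offset (suc a) ≡ 2 * offset a + 1
offset-suc a rewrite 2^a≡1+offset a = identity (offset a)
  where
  identity : ∀ r → r + suc (r + 0) ≡ 2 * r + 1
  identity = solve-∀

offset-mono : ∀ {a b} → a ≤ b → offset a ≤ offset b
offset-mono a≤b = ∸-monoˡ-≤ 1 (^-monoʳ-≤ 2 a≤b)

weight : List ℕ → ℕ
weight []      = 0
weight (a ∷ A) = offset a + weight A

weight-++ : ∀ A B → weight (A ++ B) ≡ weight A + weight B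
weight-++ []      B = refl
weight-++ (a ∷ A) B rewrite weight-++ A B = sym (+-assoc (offset a) (weight A) (weight B))

weight-replicate : ∀ r a → weight (replicate r a) ≡ r * offset a
weight-replicate zero    a = refl
weight-replicate (suc r) a rewrite weight-replicate r a = refl

weight-map-suc : ∀ A → weight (map suc A) ≡ 2 * weight A + length A
weight-map-suc []      = refl
weight-map-suc (a ∷ A) rewrite weight-map-suc A | offset-suc a =
  identity (offset a) (weight A) (length A)
  where
  identity : ∀ x y l → 2 * x + 1 + (2 * y + l) ≡ 2 * (x + y) + suc l
  identity = solve-∀

pad : List ℕ → ℕ → List ℕ
pad A p = A ++ replicate (p ∸ length A) 0

pad-length : ∀ A {p} → length A ≤ p → length (pad A p) ≡ p
pad-length A {p} le rewrite length-++ A {replicate (p ∸ length A) 0}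
  | length-replicate (p ∸ length A) {0} = m+[n∸m]≡n le

pad-weight : ∀ A p → weight (pad A p) ≡ weight A
pad-weight A p rewrite weight-++ A (replicate (p ∸ length A) 0)
  | weight-replicate (p ∸ length A) 0 | *-zeroʳ (p ∸ length A) = +-identityʳ (weight A)

pad-bounded : ∀ {L A} p → All (_≤ L) A → All (_≤ L) (pad A p)
pad-bounded p bA = ++⁺ bA (replicate⁺ _ z≤n)

record Rep (L p q y : ℕ) : Set where
  constructor rep
  field
    A B      : List ℕ
    length-A : length A ≡ p
    length-B : length B ≡ q
    bound-A  : All (_≤ L) A
    bound-B  : All (_≤ L) B
    balance  : weight A ≡ y + weight B

Rep-padˡ : ∀ {L p q y} p' → p ≤ p' → Rep L p q y → Rep L p' q y
Rep-padˡ p' le (rep A B refl lB bA bB eq) =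
  rep (pad A p') B (pad-length A le) lB (pad-bounded p' bA) bB (trans (pad-weight A p') eq)

Rep-padʳ : ∀ {L p q y} q' → q ≤ q' → Rep L p q y → Rep L p q' y
Rep-padʳ {y = y} q' le (rep A B lA refl bA bB eq) =
  rep A (pad B q') lA (pad-length B le) bA (pad-bounded q' bB)
      (trans eq (cong (y +_) (sym (pad-weight B q'))))

Rep-cons : ∀ {L p q y a} → a ≤ L → Rep L p q y → Rep L (suc p) q (offset a + y)
Rep-cons {y = y} {a} a≤L (rep A B lA lB bA bB eq) =
  rep (a ∷ A) B (cong suc lA) lB (a≤L ∷ bA) bB
      (trans (cong (offset a +_) eq) (sym (+-assoc (offset a) y (weight B))))

Rep-double : ∀ {L p q y} → q ≤ p → Rep L p q y → Rep (suc L) p q (2 * y + (p ∸ q))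
Rep-double {p = p} {q} {y} q≤p (rep A B refl refl bA bB eq) =
  rep (map suc A) (map suc B) (length-map suc A) (length-map suc B)
      (map⁺ (All.map s≤s bA)) (map⁺ (All.map s≤s bB)) balance
  where
  open ≡-Reasoning
  identity : ∀ y w d q → 2 * (y + w) + (d + q) ≡ 2 * y + d + (2 * w + q)
  identity = solve-∀
  balance : weight (map suc A) ≡ 2 * y + (p ∸ q) + weight (map suc B)
  balance = begin
    weight (map suc A)                          ≡⟨ weight-map-suc A ⟩
    2 * weight A + p                            ≡⟨ cong₂ (λ u v → 2 * u + v) eq (sym (m∸n+n≡m q≤p)) ⟩
    2 * (y + weight B) + ((p ∸ q) + q)          ≡⟨ identity y (weight B) (p ∸ q) q ⟩
    2 * y + (p ∸ q) + (2 * weight B + q)        ≡⟨ cong (2 * y + (p ∸ q) +_) (sym (weight-map-suc B)) ⟩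
    2 * y + (p ∸ q) + weight (map suc B)        ∎

Rep-ones : ∀ {p q y} → y ≤ p → Rep 1 p q y
Rep-ones {p} {q} {y} y≤p = Rep-padʳ q z≤n (Rep-padˡ p y≤p
  (rep (replicate y 1) [] (length-replicate y) refl (replicate⁺ y ≤-refl) []
       (trans (weight-replicate y 1) (trans (*-identityʳ y) (sym (+-identityʳ y))))))

-- Near the maximum p(2^L - 1): take p top offsets and subtract the deficit with ones.
Rep-top : ∀ {L p y} → 1 ≤ L → y ≤ p * offset L → Rep L p (p * offset L ∸ y) y
Rep-top {L} {p} {y} 1≤L y≤max =
  rep (replicate p L) (replicate deficit 1) (length-replicate p) (length-replicate deficit)
      (replicate⁺ p ≤-refl) (replicate⁺ deficit 1≤L) balance
  where
  deficit : ℕ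
  deficit = p * offset L ∸ y
  open ≡-Reasoning
  balance : weight (replicate p L) ≡ y + weight (replicate deficit 1)
  balance = begin
    weight (replicate p L)            ≡⟨ weight-replicate p L ⟩
    p * offset L                      ≡⟨ m+[n∸m]≡n y≤max ⟨
    y + deficit                       ≡⟨ cong (y +_) (*-identityʳ deficit) ⟨
    y + deficit * 1                   ≡⟨ cong (y +_) (weight-replicate deficit 1) ⟨
    y + weight (replicate deficit 1)  ∎

-- Greedy extension: each additional positive term absorbs one top offset 2^L - 1.
Rep-extend : ∀ {L p q} → (∀ y → y ≤ suc p * offset L → Rep L (suc p) q y) →
  ∀ e y → y ≤ (suc p + e) * offset L → Rep L (suc p + e) q y
Rep-extend {L} {p} base zero y y≤max =
  Rep-padˡ (suc p + 0) (m≤m+n (suc p) 0) (base y (subst (λ n → y ≤ n * offset L) (+-identityʳ (suc p)) y≤max))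
Rep-extend {L} {p} {q} base (suc e) y y≤max with offset L ≤? y
... | yes top≤y = subst₂ (λ n z → Rep L n q z) (sym (+-suc (suc p) e)) (m+[n∸m]≡n top≤y)
                    (Rep-cons ≤-refl (Rep-extend base e (y ∸ offset L) rest≤))
  where
  rest≤ : y ∸ offset L ≤ (suc p + e) * offset L
  rest≤ = m≤n+o⇒m∸n≤o y (offset L) (subst (λ n → y ≤ n * offset L) (+-suc (suc p) e) y≤max)
... | no y<top = Rep-padˡ (suc p + suc e) (m≤m+n (suc p) (suc e))
                   (base y (≤-trans (<⇒≤ (≰⇒> y<top)) (m≤m+n (offset L) (p * offset L))))

represent : ∀ L p q y → L ≤ p → L ≤ q → y ≤ p * offset (suc L) → Rep (suc L) p q y
represent zero    p q y _ _ y≤max = Rep-ones (subst (y ≤_) (*-identityʳ p) y≤max)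
represent (suc M) p q y M<p M<q y≤max with m≤n⇒∃[o]m+o≡n M<p
... | e , refl = Rep-extend minimal e y y≤max
  where
  ℓ : ℕ
  ℓ = suc M
  -- With exactly ℓ positive terms: either close to the top, or halve y and recurse.
  minimal : ∀ y → y ≤ ℓ * offset (suc ℓ) → Rep (suc ℓ) ℓ q y
  minimal y y≤max with ℓ * offset (suc ℓ) ≤? y + ℓ
  ... | yes nearTop = Rep-padʳ q (≤-trans (m≤n+o⇒m∸n≤o _ y nearTop) M<q) (Rep-top (s≤s z≤n) y≤max)
  ... | no belowTop = subst (Rep (suc ℓ) ℓ q) halves
                        (Rep-padʳ q (≤-trans (m∸n≤m ℓ r) M<q)
                          (Rep-double (m∸n≤m ℓ r) (represent M ℓ (ℓ ∸ r) x (n≤1+n M) (∸-monoʳ-≤ ℓ r≤1) x≤max)))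
    where
    x r : ℕ
    x = y / 2
    r = y % 2
    r≤1 : r ≤ 1
    r≤1 = s≤s⁻¹ (m%n<n y 2)
    x≤max : x ≤ ℓ * offset ℓ
    x≤max = <⇒≤ (m<n*o⇒m/o<n (+-cancelʳ-< ℓ y _ (subst (y + ℓ <_) top≡ (≰⇒> belowTop))))
      where
      identity : ∀ l t → l * (2 * t + 1) ≡ l * t * 2 + l
      identity = solve-∀
      top≡ : ℓ * offset (suc ℓ) ≡ ℓ * offset ℓ * 2 + ℓ
      top≡ = trans (cong (ℓ *_) (offset-suc ℓ)) (identity ℓ (offset ℓ))
    halves : 2 * x + (ℓ ∸ (ℓ ∸ r)) ≡ y
    halves = trans (cong₂ _+_ (*-comm 2 x) (m∸[m∸n]≡n (≤-trans r≤1 (s≤s z≤n))))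
                   (trans (+-comm (x * 2) r) (sym (m≡m%n+[m/n]*n y 2)))

module _ {V : Set} {Adj : V → V → Set} where

  _++ʷ_ : ∀ {x y z ℓ ℓ'} → Walk Adj x y ℓ → Walk Adj y z ℓ' → Walk Adj x z (ℓ + ℓ')
  here     ++ʷ w' = w'
  step e w ++ʷ w' = step e (w ++ʷ w')

  snoc : ∀ {x y z ℓ} → Walk Adj x y ℓ → Adj y z → Walk Adj x z (suc ℓ)
  snoc here       e' = step e' here
  snoc (step e w) e' = step e (snoc w e')

  reverse : (∀ {x y} → Adj x y → Adj y x) → ∀ {x y ℓ} → Walk Adj x y ℓ → Walk Adj y x ℓ
  reverse sym-adj here       = here
  reverse sym-adj (step e w) = snoc (reverse sym-adj w) (sym-adj e)

peel : ∀ {L T y} → offset L ≤ T → y ≤ T + offset L →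
  ∃[ y' ] ∃[ a ] (y' ≤ T × a ≤ L × y' + offset a ≡ y)
peel {L} {T} {y} top≤T y≤ with y ≤? T
... | yes y≤T = y , 0 , y≤T , z≤n , +-identityʳ y
... | no  y≰T = y ∸ offset L , L , m≤n+o⇒m∸n≤o y (offset L) (subst (y ≤_) (+-comm T (offset L)) y≤) ,
                ≤-refl , m∸n+n≡m (≤-trans top≤T (<⇒≤ (≰⇒> y≰T)))

cross-step-counts : ∀ {f b ℓ k} → f + b ≡ ℓ → f + 0 ≡ b + 1 → ℓ < 2 * suc k + 1 → f ≤ suc k × b ≤ k
cross-step-counts {f} {b} {ℓ} {k} steps parity ℓ< = subst (_≤ suc k) (sym f≡) b<k+1 , s≤s⁻¹ b<k+1
  where
  f≡ : f ≡ suc b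
  f≡ = trans (sym (+-identityʳ f)) (trans parity (+-comm b 1))
  identity : ∀ b → suc b + b ≡ 2 * b + 1
  identity = solve-∀
  b<k+1 : b < suc k
  b<k+1 = *-cancelˡ-< 2 b (suc k)
            (+-cancelʳ-< 1 (2 * b) _ (subst (_< 2 * suc k + 1) (trans (sym steps) (trans (cong (_+ b) f≡) (identity b))) ℓ<))

same-step-counts : ∀ {f b ℓ k} → f + b ≡ ℓ → f + 0 ≡ b + 0 → ℓ < 2 * k + 2 → f ≤ k × b ≤ k
same-step-counts {f} {b} {ℓ} {k} steps parity ℓ< = f≤k , subst (_≤ k) f≡ f≤k
  where
  f≡ : f ≡ b
  f≡ = trans (sym (+-identityʳ f)) (trans parity (+-identityʳ b))
  doubled : ∀ f → f + f ≡ 2 * f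
  doubled = solve-∀
  bound : ∀ k → 2 * k + 2 ≡ 2 * suc k
  bound = solve-∀
  f≤k : f ≤ k
  f≤k = s≤s⁻¹ (*-cancelˡ-< 2 f (suc k)
          (subst₂ _<_ (trans (sym steps) (trans (cong (f +_) (sym f≡)) (doubled f))) (bound k) ℓ<))

module Knödel (L m' : ℕ) where

  m s : ℕ
  m = suc m'
  s = offset L

  Adj : KVertex m → KVertex m → Set
  Adj = KAdj (suc L) m

  -- Congruence modulo m (a record, so that both sides stay inferable).
  infix 4 _≡ₘ_
  record _≡ₘ_ (x y : ℕ) : Set where
    constructor residues
    field same-residue : x % m ≡ y % m

  ≡ₘ-setoid : Setoid 0ℓ 0ℓ
  ≡ₘ-setoid = record
    { Carrier       = ℕ
    ; _≈_           = _≡ₘ_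
    ; isEquivalence = record
      { refl  = residues refl
      ; sym   = λ (residues e) → residues (sym e)
      ; trans = λ (residues e) (residues e') → residues (trans e e')
      }
    }

  open Setoid ≡ₘ-setoid public using () renaming (refl to reflₘ; sym to symₘ; trans to transₘ)
  module ≡ₘ-Reasoning = SetoidReasoning ≡ₘ-setoid

  +-congₘ : ∀ {x x' y y'} → x ≡ₘ x' → y ≡ₘ y' → x + y ≡ₘ x' + y'
  +-congₘ {x} {x'} {y} {y'} (residues x≡x') (residues y≡y') = residues (begin
    (x + y) % m                 ≡⟨ %-distribˡ-+ x y m ⟩
    (x % m + y % m) % m         ≡⟨ cong₂ (λ a b → (a + b) % m) x≡x' y≡y' ⟩
    (x' % m + y' % m) % m       ≡⟨ %-distribˡ-+ x' y' m ⟨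
    (x' + y') % m               ∎)
    where open ≡-Reasoning

  +-multipleₘ : ∀ x k → x + k * m ≡ₘ x
  +-multipleₘ x k = residues ([m+kn]%n≡m%n x k m)

  +-cancelʳₘ : ∀ {x y} d → x + d ≡ₘ y + d → x ≡ₘ y
  +-cancelʳₘ {x} {y} d x+d≡y+d = begin
    x                   ≈⟨ symₘ (+-multipleₘ x d) ⟩
    x + d * m           ≡⟨ identity x d m' ⟩
    x + d + d * m'      ≈⟨ +-congₘ x+d≡y+d reflₘ ⟩
    y + d + d * m'      ≡⟨ identity y d m' ⟨
    y + d * m           ≈⟨ +-multipleₘ y d ⟩
    y                   ∎
    where
    open ≡ₘ-Reasoning
    identity : ∀ z d n → z + d * suc n ≡ z + d + d * n
    identity = solve-∀

  ≡ₘ⇒≡ : ∀ {x y} → x < m → y < m → x ≡ₘ y → x ≡ y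
  ≡ₘ⇒≡ x<m y<m (residues e) = trans (sym (m<n⇒m%n≡m x<m)) (trans e (m<n⇒m%n≡m y<m))

  toℕ-mod : ∀ x → toℕ (x mod m) ≡ₘ x
  toℕ-mod x = residues (trans (cong (_% m) (Finₚ.toℕ-fromℕ< (m%n<n x m))) (m%n%n≡m%n x m))

  edge⇒≡ₘ : ∀ {i j} → KEdge (suc L) m i j → ∃[ a ] (a ≤ L × toℕ i + offset a ≡ₘ toℕ j)
  edge⇒≡ₘ {i} {j} (a , s≤s a≤L , q , eq) =
    a , a≤L , transₘ (residues (cong (_% m) eq)) (+-multipleₘ (toℕ j) q)

  ≡ₘ⇒edge : ∀ {i j a} → a ≤ L → toℕ i + offset a ≡ₘ toℕ j → KEdge (suc L) m i j
  ≡ₘ⇒edge {i} {j} {a} a≤L (residues e) =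
    a , s≤s a≤L , x / m , trans (m≡m%n+[m/n]*n x m) (cong (_+ x / m * m) (trans e (m<n⇒m%n≡m (Finₚ.toℕ<n j))))
    where
    x : ℕ
    x = toℕ i + offset a

  adj-sym : ∀ {x y} → Adj x y → Adj y x
  adj-sym {inj₁ _} {inj₂ _} e = e
  adj-sym {inj₂ _} {inj₁ _} e = e

  forward : ∀ i {a} → a ≤ L → ∃[ j ] (Adj (inj₁ i) (inj₂ j) × toℕ i + offset a ≡ₘ toℕ j)
  forward i {a} a≤L = x mod m , ≡ₘ⇒edge a≤L (symₘ (toℕ-mod x)) , symₘ (toℕ-mod x)
    where
    x : ℕ
    x = toℕ i + offset a

  backward : ∀ j {a} → a ≤ L → ∃[ i ] (Adj (inj₂ j) (inj₁ i) × toℕ i + offset a ≡ₘ toℕ j)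
  backward j {a} a≤L = x mod m , ≡ₘ⇒edge a≤L arrives , arrives
    where
    x : ℕ
    x = toℕ j + offset a * m'
    open ≡ₘ-Reasoning
    identity : ∀ j a n → j + a * n + a ≡ j + a * suc n
    identity = solve-∀
    arrives : toℕ (x mod m) + offset a ≡ₘ toℕ j
    arrives = begin
      toℕ (x mod m) + offset a     ≈⟨ +-congₘ (toℕ-mod x) reflₘ ⟩
      x + offset a                 ≡⟨ identity (toℕ j) (offset a) m' ⟩
      toℕ j + offset a * m         ≈⟨ +-multipleₘ (toℕ j) (offset a) ⟩
      toℕ j                        ∎

  data Side : Set where
    U V : Side

  vertex : Side → Fin m → KVertex m
  vertex U i = inj₁ i
  vertex V j = inj₂ j

  twoStep : ∀ σ i {a b} → a ≤ L → b ≤ L →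
    ∃[ i' ] (toℕ i' + offset b ≡ₘ toℕ i + offset a × Walk Adj (vertex σ i) (vertex σ i') 2)
  twoStep U i a≤L b≤L with forward i a≤L
  ... | j , e₁ , i+a≡j with backward j b≤L
  ...   | i' , e₂ , i'+b≡j = i' , transₘ i'+b≡j (symₘ i+a≡j) , step {y = inj₂ j} e₁ (step e₂ here)
  twoStep V j {a} {b} a≤L b≤L with backward j b≤L
  ... | i , e₁ , i+b≡j with forward i a≤L
  ...   | j' , e₂ , i+a≡j' = j' , shifted , step {y = inj₁ i} e₁ (step e₂ here)
    where
    open ≡ₘ-Reasoning
    shifted : toℕ j' + offset b ≡ₘ toℕ j + offset a
    shifted = begin
      toℕ j' + offset b              ≈⟨ +-congₘ (symₘ i+a≡j') reflₘ ⟩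
      toℕ i + offset a + offset b    ≡⟨ xy∙z≈xz∙y (toℕ i) (offset a) (offset b) ⟩
      toℕ i + offset b + offset a    ≈⟨ +-congₘ i+b≡j reflₘ ⟩
      toℕ j + offset a               ∎

  evenWalk : ∀ σ (A B : List ℕ) i j → length A ≡ length B → All (_≤ L) A → All (_≤ L) B →
    toℕ i + weight A ≡ₘ toℕ j + weight B → Walk Adj (vertex σ i) (vertex σ j) (length A * 2)
  evenWalk σ [] [] i j _ _ _ i≡j = subst (λ j → Walk Adj (vertex σ i) (vertex σ j) 0) same here
    where
    same : i ≡ j
    same = Finₚ.toℕ-injective (≡ₘ⇒≡ (Finₚ.toℕ<n i) (Finₚ.toℕ<n j)
             (transₘ (residues (cong (_% m) (sym (+-identityʳ (toℕ i)))))
                     (transₘ i≡j (residues (cong (_% m) (+-identityʳ (toℕ j)))))))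
  evenWalk σ (a ∷ A) (b ∷ B) i j |A|≡|B| (a≤L ∷ bA) (b≤L ∷ bB) balanced with twoStep σ i a≤L b≤L
  ... | i' , shifted , walk₂ = walk₂ ++ʷ evenWalk σ A B i' j (suc-injective |A|≡|B|) bA bB rest
    where
    open ≡ₘ-Reasoning
    rest : toℕ i' + weight A ≡ₘ toℕ j + weight B
    rest = +-cancelʳₘ (offset b) (begin
      toℕ i' + weight A + offset b       ≡⟨ xy∙z≈xz∙y (toℕ i') (weight A) (offset b) ⟩
      toℕ i' + offset b + weight A       ≈⟨ +-congₘ shifted reflₘ ⟩
      toℕ i + offset a + weight A        ≡⟨ +-assoc (toℕ i) (offset a) (weight A) ⟩
      toℕ i + (offset a + weight A)      ≈⟨ balanced ⟩
      toℕ j + (offset b + weight B)      ≡⟨ cong (toℕ j +_) (+-comm (offset b) (weight B)) ⟩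
      toℕ j + (weight B + offset b)      ≡⟨ +-assoc (toℕ j) (weight B) (offset b) ⟨
      toℕ j + weight B + offset b        ∎)

  Representable : ℕ → Set
  Representable t = ∀ y → y ≤ t * s → Rep L t t y

  shiftWalk : ∀ {t} → Representable t → ∀ σ i j y → y ≤ t * s → toℕ i + y ≡ₘ toℕ j →
    Walk Adj (vertex σ i) (vertex σ j) (t * 2)
  shiftWalk rep-t σ i j y y≤ts i+y≡j with rep-t y y≤ts
  ... | rep A B refl |B|≡t bA bB eq = evenWalk σ A B i j (sym |B|≡t) bA bB (begin
    toℕ i + weight A             ≡⟨ cong (toℕ i +_) eq ⟩
    toℕ i + (y + weight B)       ≡⟨ +-assoc (toℕ i) y (weight B) ⟨
    toℕ i + y + weight B         ≈⟨ +-congₘ i+y≡j reflₘ ⟩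
    toℕ j + weight B             ∎)
    where open ≡ₘ-Reasoning

  split-≤ : ∀ {i j P Q} → i ≤ j → j < m → m ≤ suc (P + Q) →
    ∃[ y ] (y ≤ P × i + y ≡ₘ j) ⊎ ∃[ y ] (y ≤ Q × j + y ≡ₘ i)
  split-≤ {i} {j} {P} {Q} i≤j j<m m≤ with j ∸ i ≤? P
  ... | yes d≤P = inj₁ (j ∸ i , d≤P , residues (cong (_% m) (m+[n∸m]≡n i≤j)))
  ... | no  d≰P = inj₂ (m ∸ (j ∸ i) , wrap≤Q , residues wraps)
    where
    wrap≤Q : m ∸ (j ∸ i) ≤ Q
    wrap≤Q = ≤-trans (∸-monoˡ-≤ (j ∸ i) m≤) (≤-trans (∸-monoʳ-≤ (suc (P + Q)) (≰⇒> d≰P))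
               (≤-reflexive (m+n∸m≡n P Q)))
    open ≡-Reasoning
    wraps : (j + (m ∸ (j ∸ i))) % m ≡ i % m
    wraps = begin
      (j + (m ∸ (j ∸ i))) % m             ≡⟨ cong (λ z → (z + (m ∸ (j ∸ i))) % m) (m+[n∸m]≡n i≤j) ⟨
      (i + (j ∸ i) + (m ∸ (j ∸ i))) % m   ≡⟨ cong (_% m) (+-assoc i (j ∸ i) _) ⟩
      (i + ((j ∸ i) + (m ∸ (j ∸ i)))) % m ≡⟨ cong (λ z → (i + z) % m) (m+[n∸m]≡n (≤-trans (m∸n≤m j i) (<⇒≤ j<m))) ⟩
      (i + m) % m                         ≡⟨ [m+n]%n≡m%n i m ⟩
      i % m                               ∎

  split : ∀ {i j P Q} → i < m → j < m → m ≤ suc (P + Q) →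
    ∃[ y ] (y ≤ P × i + y ≡ₘ j) ⊎ ∃[ y ] (y ≤ Q × j + y ≡ₘ i)
  split {i} {j} {P} {Q} i<m j<m m≤ with ≤-total i j
  ... | inj₁ i≤j = split-≤ i≤j j<m m≤
  ... | inj₂ j≤i = Sum.swap (split-≤ j≤i i<m (subst (λ n → m ≤ suc n) (+-comm P Q) m≤))

  sameSideWalk : ∀ {t} → Representable t → m ≤ suc (t * s + t * s) →
    ∀ σ i j → Walk Adj (vertex σ i) (vertex σ j) (t * 2)
  sameSideWalk rep-t m≤ σ i j with split (Finₚ.toℕ<n i) (Finₚ.toℕ<n j) m≤
  ... | inj₁ (y , y≤ , i+y≡j) = shiftWalk rep-t σ i j y y≤ i+y≡j
  ... | inj₂ (y , y≤ , j+y≡i) = reverse adj-sym (shiftWalk rep-t σ j i y y≤ j+y≡i)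

  -- Upper bound for u_i and v_j: an even walk inside U followed by one edge.
  crossWalk : ∀ {t} → Representable t → s ≤ t * s → m ≤ suc ((t * s + s) + t * s) →
    ∀ i j → Walk Adj (inj₁ i) (inj₂ j) (suc (t * 2))
  crossWalk rep-t s≤ts m≤ i j with split (Finₚ.toℕ<n i) (Finₚ.toℕ<n j) m≤
  ... | inj₂ (y , y≤ , j+y≡i) =
    snoc (reverse adj-sym (shiftWalk rep-t U j i y y≤ j+y≡i)) (≡ₘ⇒edge z≤n (residues (cong (_% m) (+-identityʳ (toℕ j)))))
  ... | inj₁ (y , y≤ , i+y≡j) with peel s≤ts y≤
  ...   | y' , a , y'≤ , a≤L , y'+a≡y = snoc (shiftWalk rep-t U i Q y' y'≤ (symₘ (toℕ-mod x))) (≡ₘ⇒edge a≤L lands)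
    where
    x : ℕ
    x = toℕ i + y'
    Q : Fin m
    Q = x mod m
    open ≡ₘ-Reasoning
    lands : toℕ Q + offset a ≡ₘ toℕ j
    lands = begin
      toℕ Q + offset a          ≈⟨ +-congₘ (toℕ-mod x) reflₘ ⟩
      toℕ i + y' + offset a     ≡⟨ +-assoc (toℕ i) y' (offset a) ⟩
      toℕ i + (y' + offset a)   ≡⟨ cong (toℕ i +_) y'+a≡y ⟩
      toℕ i + y                 ≈⟨ i+y≡j ⟩
      toℕ j                     ∎

  allWithin : ∀ {tᵤ tᵥ D} → Representable tᵤ → Representable tᵥ → s ≤ tᵥ * s →
    m ≤ suc (tᵤ * s + tᵤ * s) → m ≤ suc ((tᵥ * s + s) + tᵥ * s) →
    tᵤ * 2 ≤ D → suc (tᵥ * 2) ≤ D → ∀ x y → DistLe Adj x y D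
  allWithin {tᵤ} rep-u _ _ mᵤ _ evenD _ (inj₁ i) (inj₁ j) = tᵤ * 2 , evenD , sameSideWalk rep-u mᵤ U i j
  allWithin {tᵤ} rep-u _ _ mᵤ _ evenD _ (inj₂ i) (inj₂ j) = tᵤ * 2 , evenD , sameSideWalk rep-u mᵤ V i j
  allWithin {tᵥ = tᵥ} _ rep-v s≤ _ mᵥ _ oddD (inj₁ i) (inj₂ j) =
    suc (tᵥ * 2) , oddD , crossWalk rep-v s≤ mᵥ i j
  allWithin {tᵥ = tᵥ} _ rep-v s≤ _ mᵥ _ oddD (inj₂ j) (inj₁ i) =
    suc (tᵥ * 2) , oddD , reverse adj-sym (crossWalk rep-v s≤ mᵥ i j)

  val : KVertex m → ℕ
  val (inj₁ i) = toℕ i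
  val (inj₂ j) = toℕ j

  side : KVertex m → ℕ
  side (inj₁ _) = 0
  side (inj₂ _) = 1

  -- What a walk x → z of length ℓ records: fwd steps U → V and bwd steps V → U
  -- (so fwd - bwd = side z - side x), with val x + F ≡ val z + B, F ≤ fwd·s, B ≤ bwd·s.
  record Displacement (x z : KVertex m) (ℓ : ℕ) : Set where
    constructor displaced
    field
      fwd bwd F B : ℕ
      steps       : fwd + bwd ≡ ℓ
      parity      : fwd + side x ≡ bwd + side z
      F≤          : F ≤ fwd * s
      B≤          : B ≤ bwd * s
      shift       : val x + F ≡ₘ val z + B

  displacement : ∀ {x z ℓ} → Walk Adj x z ℓ → Displacement x z ℓ
  displacement here = displaced 0 0 0 0 refl refl z≤n z≤n reflₘ
  displacement {inj₁ i} {z} (step {y = inj₂ j} e w) with edge⇒≡ₘ e | displacement w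
  ... | a , a≤L , i+a≡j | displaced f b F B steps parity F≤ B≤ shift =
    displaced (suc f) b (offset a + F) B (cong suc steps)
      (trans (+-identityʳ (suc f)) (trans (+-comm 1 f) parity))
      (+-mono-≤ (offset-mono a≤L) F≤) B≤
      (begin
        toℕ i + (offset a + F)   ≡⟨ +-assoc (toℕ i) (offset a) F ⟨
        toℕ i + offset a + F     ≈⟨ +-congₘ i+a≡j reflₘ ⟩
        toℕ j + F                ≈⟨ shift ⟩
        val z + B                ∎)
    where open ≡ₘ-Reasoning
  displacement {inj₂ j} {z} (step {y = inj₁ i} e w) with edge⇒≡ₘ e | displacement w
  ... | a , a≤L , i+a≡j | displaced f b F B steps parity F≤ B≤ shift =
    displaced f (suc b) F (offset a + B) (trans (+-suc f b) (cong suc steps))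
      (trans (+-comm f 1) (cong suc (trans (sym (+-identityʳ f)) parity)))
      F≤ (+-mono-≤ (offset-mono a≤L) B≤)
      (begin
        toℕ j + F                ≈⟨ +-congₘ (symₘ i+a≡j) reflₘ ⟩
        toℕ i + offset a + F     ≡⟨ xy∙z≈xz∙y (toℕ i) (offset a) F ⟩
        toℕ i + F + offset a     ≈⟨ +-congₘ shift reflₘ ⟩
        val z + B + offset a     ≡⟨ xy∙z≈xz∙y (val z) B (offset a) ⟩
        val z + offset a + B     ≡⟨ +-assoc (val z) (offset a) B ⟩
        val z + (offset a + B)   ∎)
    where open ≡ₘ-Reasoning
  displacement {inj₁ _} (step {y = inj₁ _} () _)
  displacement {inj₂ _} (step {y = inj₂ _} () _)

  origin : KVertex m
  origin = inj₁ Fin.zero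

  -- Starting from u_0 with at most f forward and b backward steps, the index stays in
  -- [0, f·s] - [0, b·s] mod m, so a vertex z with f·s < val z and val z + b·s < m is missed.
  beyondReach : ∀ {z ℓ f b} (d : Displacement origin z ℓ) →
    Displacement.fwd d ≤ f → Displacement.bwd d ≤ b → f * s < val z → val z + b * s < m → ⊥
  beyondReach {z} {f = f} {b} (displaced f' b' F B _ _ F≤ B≤ shift) f'≤f b'≤b fs<z z+bs<m =
    <-irrefl F≡z+B (<-≤-trans F<z (m≤m+n (val z) B))
    where
    F<z : F < val z
    F<z = ≤-<-trans (≤-trans F≤ (*-monoˡ-≤ s f'≤f)) fs<z
    z+B<m : val z + B < m
    z+B<m = ≤-<-trans (+-monoʳ-≤ (val z) (≤-trans B≤ (*-monoˡ-≤ s b'≤b))) z+bs<m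
    F≡z+B : F ≡ val z + B
    F≡z+B = ≡ₘ⇒≡ (<-trans F<z (≤-<-trans (m≤m+n (val z) B) z+B<m)) z+B<m shift

  crossFarPair : ∀ k → suc (suc k * s + k * s) < m →
    ∃[ x ] ∃[ y ] ((ℓ : ℕ) → ℓ < 2 * suc k + 1 → ¬ Walk Adj x y ℓ)
  crossFarPair k far = origin , inj₂ J , unreachable
    where
    J< : suc (suc k * s) < m
    J< = ≤-<-trans (s≤s (m≤m+n (suc k * s) (k * s))) far
    J : Fin m
    J = fromℕ< J<
    J≡ : toℕ J ≡ suc (suc k * s)
    J≡ = Finₚ.toℕ-fromℕ< J<
    unreachable : (ℓ : ℕ) → ℓ < 2 * suc k + 1 → ¬ Walk Adj origin (inj₂ J) ℓ
    unreachable ℓ ℓ< w with displacement w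
    ... | d@(displaced _ _ _ _ steps parity _ _ _) with cross-step-counts {k = k} steps parity ℓ<
    ...   | f≤ , b≤ = beyondReach d f≤ b≤ (subst (suc k * s <_) (sym J≡) ≤-refl)
                        (subst (λ v → v + k * s < m) (sym J≡) far)

  sameFarPair : ∀ k → suc (k * s + k * s) < m →
    ∃[ x ] ∃[ y ] ((ℓ : ℕ) → ℓ < 2 * k + 2 → ¬ Walk Adj x y ℓ)
  sameFarPair k far = origin , inj₁ J , unreachable
    where
    J< : suc (k * s) < m
    J< = ≤-<-trans (s≤s (m≤m+n (k * s) (k * s))) far
    J : Fin m
    J = fromℕ< J<
    J≡ : toℕ J ≡ suc (k * s)
    J≡ = Finₚ.toℕ-fromℕ< J<
    unreachable : (ℓ : ℕ) → ℓ < 2 * k + 2 → ¬ Walk Adj origin (inj₁ J) ℓ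
    unreachable ℓ ℓ< w with displacement w
    ... | d@(displaced _ _ _ _ steps parity _ _ _) with same-step-counts {k = k} steps parity ℓ<
    ...   | f≤ , b≤ = beyondReach d f≤ b≤ (subst (k * s <_) (sym J≡) ≤-refl)
                        (subst (λ v → v + k * s < m) (sym J≡) far)

-- The range of part (i) (with k + 1 for k), halved to m: room for the far vertex
-- v_{(k+1)s+1}, and the conditions of `allWithin` with tᵤ = tᵥ = k + 1.
range-i : ∀ {m k s} → (4 * suc k ∸ 2) * s + 4 ≤ 2 * m → 2 * m ≤ 4 * suc k * s + 2 →
  suc (suc k * s + k * s) < m × m ≤ suc (suc k * s + suc k * s) × m ≤ suc ((suc k * s + s) + suc k * s)
range-i {m} {k} {s} lo hi = far , m≤ᵤ , ≤-trans m≤ᵤ (s≤s (+-monoˡ-≤ (suc k * s) (m≤m+n (suc k * s) s)))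
  where
  four : ∀ k → 4 * suc k ≡ 2 + (4 * k + 2)
  four = solve-∀
  lower : ∀ k s → (4 * k + 2) * s + 4 ≡ 2 * suc (suc (suc k * s + k * s))
  lower = solve-∀
  upper : ∀ k s → 4 * suc k * s + 2 ≡ 2 * suc (suc k * s + suc k * s)
  upper = solve-∀
  far : suc (suc k * s + k * s) < m
  far = *-cancelˡ-≤ 2 (subst (_≤ 2 * m) (trans (cong (λ n → (n ∸ 2) * s + 4) (four k)) (lower k s)) lo)
  m≤ᵤ : m ≤ suc (suc k * s + suc k * s)
  m≤ᵤ = *-cancelˡ-≤ 2 (subst (2 * m ≤_) (upper k s) hi)

-- The range of part (ii), halved: room for u_{ks+1}, and `allWithin` with tᵤ = k + 1, tᵥ = k.
range-ii : ∀ {m k s} → 4 * k * s + 4 ≤ 2 * m → 2 * m ≤ (4 * k + 2) * s + 2 →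
  suc (k * s + k * s) < m × m ≤ suc (suc k * s + suc k * s) × m ≤ suc ((k * s + s) + k * s)
range-ii {m} {k} {s} lo hi = far , ≤-trans m≤ᵥ (s≤s (subst ((k * s + s) + k * s ≤_) (sym (widen k s)) (m≤m+n _ s))) , m≤ᵥ
  where
  lower : ∀ k s → 4 * k * s + 4 ≡ 2 * suc (suc (k * s + k * s))
  lower = solve-∀
  upper : ∀ k s → (4 * k + 2) * s + 2 ≡ 2 * suc ((k * s + s) + k * s)
  upper = solve-∀
  widen : ∀ k s → suc k * s + suc k * s ≡ (k * s + s) + k * s + s
  widen = solve-∀
  far : suc (k * s + k * s) < m
  far = *-cancelˡ-≤ 2 (subst (_≤ 2 * m) (lower k s) lo)
  m≤ᵥ : m ≤ suc ((k * s + s) + k * s)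
  m≤ᵥ = *-cancelˡ-≤ 2 (subst (2 * m ≤_) (upper k s) hi)

odd-length : ∀ k → suc (k * 2) ≡ 2 * k + 1
odd-length = solve-∀

even-length : ∀ k → suc k * 2 ≡ 2 * k + 2
even-length = solve-∀

no-room : ∀ x → ¬ (x + 4 ≤ 0)
no-room x le with ≤-trans (m≤n+m 4 x) le
... | ()

mainTheorem14 : (Δ n m k : ℕ) → n ≡ 2 * m → 1 ≤ Δ → Δ ≤ ⌊log₂ n ⌋ → 3 ≤ Δ →
    Δ ∸ 2 ≤ k →
    (((4 * k ∸ 2) * (2 ^ (Δ ∸ 1) ∸ 1) + 4 ≤ n → n ≤ 4 * k * (2 ^ (Δ ∸ 1) ∸ 1) + 2 →
        HasDiameter (KVertex m) (KAdj Δ m) (2 * k + 1))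
     ×
     (4 * k * (2 ^ (Δ ∸ 1) ∸ 1) + 4 ≤ n → n ≤ (4 * k + 2) * (2 ^ (Δ ∸ 1) ∸ 1) + 2 →
        HasDiameter (KVertex m) (KAdj Δ m) (2 * k + 2)))
mainTheorem14 zero _ _ _ _ _ _ () _
mainTheorem14 (suc zero) _ _ _ _ _ _ (s≤s ()) _
mainTheorem14 (suc (suc zero)) _ _ _ _ _ _ (s≤s (s≤s ())) _
mainTheorem14 (suc (suc (suc d))) _ _ zero _ _ _ _ ()
mainTheorem14 (suc (suc (suc d))) _ zero (suc k) refl _ _ _ _ =
  (λ lo _ → ⊥-elim (no-room _ lo)) , (λ lo _ → ⊥-elim (no-room _ lo))
mainTheorem14 (suc (suc (suc d))) _ (suc m') (suc k) refl _ _ _ d<k+1 = part-i , part-ii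
  where
  open Knödel (suc (suc d)) m'
  representable : ∀ t → suc d ≤ t → Representable t
  representable t d<t y = represent (suc d) t t y d<t d<t
  s≤ : s ≤ suc k * s
  s≤ = m≤m+n s (k * s)
  part-i : (4 * suc k ∸ 2) * s + 4 ≤ 2 * m → 2 * m ≤ 4 * suc k * s + 2 →
    HasDiameter (KVertex m) Adj (2 * suc k + 1)
  part-i lo hi with range-i {m} {k} {s} lo hi
  ... | far , m≤ᵤ , m≤ᵥ =
    allWithin (representable (suc k) d<k+1) (representable (suc k) d<k+1) s≤ m≤ᵤ m≤ᵥ
      (≤-trans (n≤1+n _) (≤-reflexive (odd-length (suc k)))) (≤-reflexive (odd-length (suc k))) ,
    crossFarPair k far
  part-ii : 4 * suc k * s + 4 ≤ 2 * m → 2 * m ≤ (4 * suc k + 2) * s + 2 →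
    HasDiameter (KVertex m) Adj (2 * suc k + 2)
  part-ii lo hi with range-ii {m} {suc k} {s} lo hi
  ... | far , m≤ᵤ , m≤ᵥ =
    allWithin (representable (suc (suc k)) (≤-trans d<k+1 (n≤1+n _))) (representable (suc k) d<k+1) s≤ m≤ᵤ m≤ᵥ
      (≤-reflexive (even-length (suc k))) (≤-trans (n≤1+n _) (≤-reflexive (even-length (suc k)))) ,
    sameFarPair (suc k) far
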